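{- In the $\mathcal M$-adhesive category $\mathbf{Graphs}$ (with $\mathcal M$ the injective graph morphisms), there is in general no finite set of finite transformation pairs that is complete with respect to parallel dependence: there exist finite rules $\rho_1=\langle p_1,ac_{L_1}\rangle$ and $\rho_2=\langle p_2,ac_{L_2}\rangle$ such that no finite set $\mathcal S$ of transformation pairs via $\rho_1,\rho_2$ between finite graphs is complete with respect to parallel dependence.
   Context: Application conditions (ACs) over a graph $P$: for every graph morphism $a\colon P\to C$ and AC $ac_C$ over $C$, $\exists(a,ac_C)$ is an AC over $P$; negations and finite conjunctions of ACs over $P$ are ACs over $P$ (the empty conjunction is $\mathrm{true}$). A morphism $p\colon P\to G$ satisfies $\exists(a,ac_C)$ if there is an injective $q\colon C\to G$ with $q\circ a=p$ and $q\models ac_C$; $\neg$ and $\wedge$ are interpreted as usual. A rule $\rho=\langle p,ac_L\rangle$ consists of a span $p=(L\leftarrow I\rightarrow R)$ of injective graph morphisms and an AC $ac_L$ over $L$; it is finite if $L,I,R$ and all graphs occurring in $ac_L$ are finite. A direct transformation $G\Rightarrow_{\rho,m}H$ is a double pushout diagram for $p$ with match $m\colon L\to G$ (intermediate graph $D$, $k\colon D\to G$, $c\colon D\to H$) such that $m\models ac_L$. A pair $H_1\Leftarrow_{\rho_1,m_1}G\Rightarrow_{\rho_2,m_2}H_2$ (with $k_i\colon D_i\to G$, $c_i\colon D_i\to H_i$) is parallel independent if there exist $d_{12}\colon L_1\to D_2$ with $k_2\circ d_{12}=m_1$ and $c_2\circ d_{12}\models ac_{L_1}$, and $d_{21}\colon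 L_2\to D_1$ with $k_1\circ d_{21}=m_2$ and $c_1\circ d_{21}\models ac_{L_2}$; otherwise it is parallel dependent. A pair $P_1\Leftarrow_{\rho_1,o_1}K\Rightarrow_{\rho_2,o_2}P_2$ can be embedded into $H_1\Leftarrow_{\rho_1,m_1}G\Rightarrow_{\rho_2,m_2}H_2$ via extension morphism $m\colon K\to G$ if $m_j=m\circ o_j$ and for each $j$ there are morphisms between intermediate and result graphs making all squares between the two double pushout diagrams commute and be pushouts. A set $\mathcal S$ of transformation pairs via $\rho_1,\rho_2$ is complete w.r.t. parallel dependence if for every parallel dependent pair $H_1\Leftarrow_{\rho_1,m_1}G\Rightarrow_{\rho_2,m_2}H_2$ there is a pair in $\mathcal S$ that can be embedded into it via some extension morphism. -}

module Defs where

open import Level using (Level; 0ℓ) renaming (suc to lsuc)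
open import Data.Nat using (ℕ)
open import Data.Fin using (Fin)
open import Data.Product using (Σ; Σ-syntax; ∃; ∃-syntax; _×_; _,_)
open import Relation.Binary.PropositionalEquality using (_≡_)
open import Relation.Nullary using (¬_)
open import Function.Bundles using (_↔_)
open import Function.Definitions using (Injective)

record Graph : Set₁ where
  field
    V   : Set
    E   : Set
    src : E → V
    tgt : E → V
open Graph public

record Hom (G H : Graph) : Set where
  field
    fV : V G → V H
    fE : E G → E H
    src-pres : ∀ e → src H (fE e) ≡ fV (src G e)
    tgt-pres : ∀ e → tgt H (fE e) ≡ fV (tgt G e)
open Hom public

idH : ∀ {G} → Hom G G
idH = record { fV = λ x → x ; fE = λ e → e
             ; src-pres = λ e → Relation.Binary.PropositionalEquality.refl
             ; tgt-pres = λ e → Relation.Binary.PropositionalEquality.refl }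

infixr 9 _∘H_
_∘H_ : ∀ {A B C} → Hom B C → Hom A B → Hom A C
_∘H_ {A} {B} {C} g f = record
  { fV = λ x → fV g (fV f x)
  ; fE = λ e → fE g (fE f e)
  ; src-pres = λ e → Relation.Binary.PropositionalEquality.trans (src-pres g (fE f e))
                       (Relation.Binary.PropositionalEquality.cong (fV g) (src-pres f e))
  ; tgt-pres = λ e → Relation.Binary.PropositionalEquality.trans (tgt-pres g (fE f e))
                       (Relation.Binary.PropositionalEquality.cong (fV g) (tgt-pres f e))
  }

infix 4 _≈H_
_≈H_ : ∀ {A B} → Hom A B → Hom A B → Set
f ≈H g = (∀ x → fV f x ≡ fV g x) × (∀ e → fE f e ≡ fE g e)

IsInjective : ∀ {A B} → Hom A B → Set
IsInjective f = Injective _≡_ _≡_ (fV f) × Injective _≡_ _≡_ (fE f)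

FiniteGraph : Graph → Set
FiniteGraph G = (Σ[ n ∈ ℕ ] (V G ↔ Fin n)) × (Σ[ n ∈ ℕ ] (E G ↔ Fin n))

-- pushout square in Graphs:
--      f
--   A ---> B
--   |      |
--  g|      |h
--   v      v
--   C ---> D
--      k
record IsPushout {A B C D : Graph} (f : Hom A B) (g : Hom A C)
                 (h : Hom B D) (k : Hom C D) : Set₁ where
  field
    commutes : h ∘H f ≈H k ∘H g
    universal : (X : Graph) (u : Hom B X) (v : Hom C X) → u ∘H f ≈H v ∘H g →
      Σ[ w ∈ Hom D X ] ((w ∘H h ≈H u) × (w ∘H k ≈H v) ×
        ((w' : Hom D X) → w' ∘H h ≈H u → w' ∘H k ≈H v → w' ≈H w))

data AC (P : Graph) : Set₁ where
  ex  : {C : Graph} → Hom P C → AC C → AC P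
  neg : AC P → AC P
  and : (n : ℕ) → (Fin n → AC P) → AC P   -- finite conjunction (n = 0: true)

infix 4 _⊨_
_⊨_ : ∀ {P G} → Hom P G → AC P → Set
_⊨_ {G = G} p (ex {C} a ac) =
  Σ[ q ∈ Hom C G ] (IsInjective q × (q ∘H a ≈H p) × (q ⊨ ac))
p ⊨ neg ac = ¬ (p ⊨ ac)
p ⊨ and n acs = (i : Fin n) → p ⊨ acs i

FiniteAC : ∀ {P} → AC P → Set
FiniteAC (ex {C} a ac) = FiniteGraph C × FiniteAC ac
FiniteAC (neg ac) = FiniteAC ac
FiniteAC (and n acs) = (i : Fin n) → FiniteAC (acs i)

record Rule : Set₁ where
  field
    L I R : Graph
    l : Hom I L
    r : Hom I R
    l-inj : IsInjective l
    r-inj : IsInjective r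
    acL : AC L
open Rule public

FiniteRule : Rule → Set
FiniteRule ρ = FiniteGraph (L ρ) × FiniteGraph (I ρ) × FiniteGraph (R ρ) × FiniteAC (acL ρ)

-- direct transformation G ⇒_{ρ,m} H (a DPO diagram with match m, m ⊨ acL)
--   L <-l-- I --r-> R
--   |m      |e      |n
--   G <-k-- D --c-> H
record DirectTrans (ρ : Rule) (G H : Graph) : Set₁ where
  field
    m : Hom (L ρ) G
    D : Graph
    e : Hom (I ρ) D
    k : Hom D G
    c : Hom D H
    n : Hom (R ρ) H
    po₁ : IsPushout (l ρ) e m k
    po₂ : IsPushout (r ρ) e n c
    m⊨ac : m ⊨ acL ρ
open DirectTrans public

record TransPair (ρ₁ ρ₂ : Rule) : Set₁ where
  field
    G H₁ H₂ : Graph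
    t₁ : DirectTrans ρ₁ G H₁
    t₂ : DirectTrans ρ₂ G H₂
open TransPair public

ParallelIndependent : ∀ {ρ₁ ρ₂} → TransPair ρ₁ ρ₂ → Set
ParallelIndependent {ρ₁} {ρ₂} π =
  (Σ[ d₁₂ ∈ Hom (L ρ₁) (D (t₂ π)) ]
     ((k (t₂ π) ∘H d₁₂ ≈H m (t₁ π)) × (c (t₂ π) ∘H d₁₂ ⊨ acL ρ₁)))
  × (Σ[ d₂₁ ∈ Hom (L ρ₂) (D (t₁ π)) ]
     ((k (t₁ π) ∘H d₂₁ ≈H m (t₂ π)) × (c (t₁ π) ∘H d₂₁ ⊨ acL ρ₂)))

ParallelDependent : ∀ {ρ₁ ρ₂} → TransPair ρ₁ ρ₂ → Set
ParallelDependent π = ¬ ParallelIndependent π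

record ExtendsTrans {ρ : Rule} {K P G H : Graph} (t : DirectTrans ρ K P)
                    (t' : DirectTrans ρ G H) (mK : Hom K G) : Set₁ where
  field
    match-eq : m t' ≈H mK ∘H m t
    d : Hom (D t) (D t')
    h : Hom P H
    e-eq : e t' ≈H d ∘H e t
    n-eq : n t' ≈H h ∘H n t
    po-left  : IsPushout (k t) d mK (k t')
    po-right : IsPushout (c t) d h (c t')

Embeds : ∀ {ρ₁ ρ₂} (π π' : TransPair ρ₁ ρ₂) → Hom (G π) (G π') → Set₁
Embeds π π' mK = ExtendsTrans (t₁ π) (t₁ π') mK × ExtendsTrans (t₂ π) (t₂ π') mK

Complete : ∀ {ρ₁ ρ₂} (s : ℕ) → (Fin s → TransPair ρ₁ ρ₂) → Set₁
Complete {ρ₁} {ρ₂} s S =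
  (π' : TransPair ρ₁ ρ₂) → ParallelDependent π' →
    Σ[ i ∈ Fin s ] Σ[ mK ∈ Hom (G (S i)) (G π') ] Embeds (S i) π' mK

FinitePair : ∀ {ρ₁ ρ₂} → TransPair ρ₁ ρ₂ → Set
FinitePair π = FiniteGraph (G π) × FiniteGraph (H₁ π) × FiniteGraph (H₂ π)

-- createNode adds a fresh node to any graph, under the condition acRay:
-- every node has an outgoing non-loop edge, two such edges with a common
-- target leave the same node, and some node (the origin) has no such edge
-- coming in.  Choosing an outgoing edge at every node yields an injective
-- successor map missing the origin, so no finite graph satisfies acRay
-- (finiteness makes the choice and the double negations constructive).
-- On the ray ℕ, applying createNode twice at the empty match is parallel
-- dependent: after either step the new node has no outgoing edge, so the
-- other match no longer satisfies acRay.  Hence a complete set is nonempty,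
-- yet each of its pairs starts from a graph satisfying acRay, i.e. from an
-- infinite graph.
module Submission where

open import Defs
open import Data.Nat using (ℕ; suc)
open import Data.Fin using (Fin; zero; suc)
open import Data.Fin.Properties using (0≢1+n; any?; <⇒notInjective; inj⇒≟)
import Data.Nat.Properties as ℕ
open import Data.Product using (Σ-syntax; ∃; _×_; _,_; proj₁; proj₂)
open import Data.Sum using (_⊎_; inj₁; inj₂; [_,_]′; map)
open import Data.Vec.Functional using ([]; _∷_)
open import Data.Empty using (⊥; ⊥-elim)
open import Function using (_∘_)
open import Function.Bundles using (_↔_; _⇔_; mk⇔; Inverse; Injection; Equivalence)
open import Function.Definitions using (Injective)
open import Function.Properties.Inverse using (↔-refl; ↔-sym; ↔⇒↣)
open import Relation.Binary.Definitions using (DecidableEquality)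
open import Relation.Binary.PropositionalEquality using (_≡_; _≢_; refl; sym; trans; cong; subst)
open import Relation.Nullary using (¬_; Dec; ¬?; _×-dec_)
open import Relation.Nullary.Decidable using (map′; decidable-stable)
open import Relation.Unary using (Decidable)

module _ {A : Set} {n : ℕ} (A↔Fin : A ↔ Fin n) where
  open Inverse A↔Fin using (to; from; strictlyInverseʳ)

  ↔Fin⇒≟ : DecidableEquality A
  ↔Fin⇒≟ = inj⇒≟ (↔⇒↣ A↔Fin)

  ↔Fin⇒any? : {P : A → Set} → Decidable P → Dec (∃ P)
  ↔Fin⇒any? {P} P? =
    map′ (λ (j , p) → from j , p)
         (λ (a , p) → to a , subst P (sym (strictlyInverseʳ a)) p)
         (any? (P? ∘ from))

  ↔Fin⇒¬DedekindInfinite : (f : A → A) → Injective _≡_ _≡_ f →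
                           (z : A) → (∀ a → f a ≢ z) → ⊥
  ↔Fin⇒¬DedekindInfinite f f-injective z z∉f =
    <⇒notInjective (ℕ.n<1+n n) (z∷f-injective ∘ Injection.injective (↔⇒↣ A↔Fin))
    where
    z∷f : Fin (suc n) → A
    z∷f = z ∷ f ∘ from

    z∷f-injective : Injective _≡_ _≡_ z∷f
    z∷f-injective {zero}  {zero}  _  = refl
    z∷f-injective {zero}  {suc j} eq = ⊥-elim (z∉f (from j) (sym eq))
    z∷f-injective {suc i} {zero}  eq = ⊥-elim (z∉f (from i) eq)
    z∷f-injective {suc i} {suc j} eq =
      cong suc (Injection.injective (↔⇒↣ (↔-sym A↔Fin)) (f-injective eq))

finGraph : (n m : ℕ) → (Fin m → Fin n) → (Fin m → Fin n) → Graph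
finGraph n m s t = record { V = Fin n ; E = Fin m ; src = s ; tgt = t }

finGraph-finite : ∀ {n m} → (Σ[ k ∈ ℕ ] Fin n ↔ Fin k) × (Σ[ k ∈ ℕ ] Fin m ↔ Fin k)
finGraph-finite {n} {m} = (n , ↔-refl) , (m , ↔-refl)

∅ : Graph
∅ = finGraph 0 0 (λ ()) (λ ())

• : Graph
• = finGraph 1 0 (λ ()) (λ ())

Arrow : Graph
Arrow = finGraph 2 1 (λ _ → zero) (λ _ → suc zero)

Cospan : Graph
Cospan = finGraph 3 2 (zero ∷ suc zero ∷ []) (λ _ → suc (suc zero))

¡ : ∀ {G} → Hom ∅ G
¡ = record { fV = λ () ; fE = λ () ; src-pres = λ () ; tgt-pres = λ () }

¡-injective : ∀ {G} → IsInjective (¡ {G})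
¡-injective = (λ { {()} }) , (λ { {()} })

node : ∀ {G} → V G → Hom • G
node v = record { fV = λ _ → v ; fE = λ () ; src-pres = λ () ; tgt-pres = λ () }

node-injective : ∀ {G} (v : V G) → IsInjective (node {G} v)
node-injective v = (λ { {zero} {zero} _ → refl }) , (λ { {()} })

edge : ∀ {G} → E G → Hom Arrow G
edge {G} e = record
  { fV = src G e ∷ tgt G e ∷ []
  ; fE = λ _ → e
  ; src-pres = λ _ → refl
  ; tgt-pres = λ _ → refl
  }

edge-injective : ∀ {G} (e : E G) → src G e ≢ tgt G e → IsInjective (edge {G} e)
edge-injective {G} e proper = injV , (λ { {zero} {zero} _ → refl })
  where
  injV : Injective _≡_ _≡_ (fV (edge {G} e))
  injV {zero}     {zero}     _  = refl
  injV {zero}     {suc zero} eq = ⊥-elim (proper eq)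
  injV {suc zero} {zero}     eq = ⊥-elim (proper (sym eq))
  injV {suc zero} {suc zero} _  = refl

separates : ∀ {A G} (q : Hom A G) → IsInjective q →
            ∀ {x y} → x ≢ y → fV q x ≢ fV q y
separates q q-injective x≢y = x≢y ∘ proj₁ q-injective

injective-edge-proper : ∀ {G} (q : Hom Arrow G) → IsInjective q →
                        src G (fE q zero) ≢ tgt G (fE q zero)
injective-edge-proper q q-injective eq =
  separates q q-injective 0≢1+n (trans (sym (src-pres q zero)) (trans eq (tgt-pres q zero)))

ProperEdgeFrom : (G : Graph) → V G → Set
ProperEdgeFrom G v = Σ[ e ∈ E G ] (src G e ≡ v × tgt G e ≢ v)

ProperEdgeInto : (G : Graph) → V G → Set
ProperEdgeInto G v = Σ[ e ∈ E G ] (tgt G e ≡ v × src G e ≢ v)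

properEdgeFrom-target : ∀ {G v} → ProperEdgeFrom G v → V G
properEdgeFrom-target {G} = tgt G ∘ proj₁

cospan : ∀ {G v w} (p : ProperEdgeFrom G v) (q : ProperEdgeFrom G w) →
         properEdgeFrom-target {G} p ≡ properEdgeFrom-target q → Hom Cospan G
cospan {G} {v} {w} (e₁ , src₁ , _) (e₂ , src₂ , _) sameTarget = record
  { fV = v ∷ w ∷ tgt G e₁ ∷ []
  ; fE = e₁ ∷ e₂ ∷ []
  ; src-pres = λ { zero → src₁ ; (suc zero) → src₂ }
  ; tgt-pres = λ { zero → refl ; (suc zero) → sym sameTarget }
  }

cospan-injective : ∀ {G v w} (p : ProperEdgeFrom G v) (q : ProperEdgeFrom G w) →
                   (sameTarget : properEdgeFrom-target {G} p ≡ properEdgeFrom-target q) →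
                   v ≢ w → IsInjective (cospan {G} p q sameTarget)
cospan-injective {G} p@(e₁ , src₁ , tgt₁≢) q@(e₂ , src₂ , tgt₂≢) sameTarget v≢w = injV , injE
  where
  injV : Injective _≡_ _≡_ (fV (cospan p q sameTarget))
  injV {zero}           {zero}           _  = refl
  injV {zero}           {suc zero}       eq = ⊥-elim (v≢w eq)
  injV {zero}           {suc (suc zero)} eq = ⊥-elim (tgt₁≢ (sym eq))
  injV {suc zero}       {zero}           eq = ⊥-elim (v≢w (sym eq))
  injV {suc zero}       {suc zero}       _  = refl
  injV {suc zero}       {suc (suc zero)} eq = ⊥-elim (tgt₂≢ (trans (sym sameTarget) (sym eq)))
  injV {suc (suc zero)} {zero}           eq = ⊥-elim (tgt₁≢ eq)
  injV {suc (suc zero)} {suc zero}       eq = ⊥-elim (tgt₂≢ (trans (sym sameTarget) eq))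
  injV {suc (suc zero)} {suc (suc zero)} _  = refl

  sources-differ : src G e₁ ≢ src G e₂
  sources-differ eq = v≢w (trans (sym src₁) (trans eq src₂))

  injE : Injective _≡_ _≡_ (fE (cospan p q sameTarget))
  injE {zero}     {zero}     _  = refl
  injE {zero}     {suc zero} eq = ⊥-elim (sources-differ (cong (src G) eq))
  injE {suc zero} {zero}     eq = ⊥-elim (sources-differ (cong (src G) (sym eq)))
  injE {suc zero} {suc zero} _  = refl

⊤AC : ∀ {P} → AC P
⊤AC = and 0 (λ ())

acProperEdgeFromEveryNode : AC ∅
acProperEdgeFromEveryNode = neg (ex (¡ {•}) (neg (ex (node {Arrow} zero) ⊤AC)))

acNoInjectiveCospan : AC ∅
acNoInjectiveCospan = neg (ex (¡ {Cospan}) ⊤AC)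

acNodeWithoutProperEdgeInto : AC ∅
acNodeWithoutProperEdgeInto = ex (¡ {•}) (neg (ex (node {Arrow} (suc zero)) ⊤AC))

acRay : AC ∅
acRay = and 3 ( acProperEdgeFromEveryNode
              ∷ acNoInjectiveCospan
              ∷ acNodeWithoutProperEdgeInto
              ∷ [])

acRay-finite : FiniteAC acRay
acRay-finite zero             = finGraph-finite , finGraph-finite , λ ()
acRay-finite (suc zero)       = finGraph-finite , λ ()
acRay-finite (suc (suc zero)) = finGraph-finite , finGraph-finite , λ ()

SourceDeterminedByTarget : Graph → Set
SourceDeterminedByTarget G =
  ∀ {v w} (e₁ : ProperEdgeFrom G v) (e₂ : ProperEdgeFrom G w) →
  properEdgeFrom-target {G} e₁ ≡ properEdgeFrom-target e₂ → ¬ ¬ v ≡ w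

record RayShaped (G : Graph) : Set where
  field
    properEdgeFrom : ∀ v → ¬ ¬ ProperEdgeFrom G v
    sourceDeterminedByTarget : SourceDeterminedByTarget G
    origin : V G
    origin-noProperEdgeInto : ¬ ProperEdgeInto G origin

module _ {G : Graph} (p : Hom ∅ G) where

  ⊨acProperEdgeFromEveryNode⇔ : p ⊨ acProperEdgeFromEveryNode ⇔ (∀ v → ¬ ¬ ProperEdgeFrom G v)
  ⊨acProperEdgeFromEveryNode⇔ = mk⇔ to from
    where
    to : p ⊨ acProperEdgeFromEveryNode → ∀ v → ¬ ¬ ProperEdgeFrom G v
    to sat v noEdge = sat (node {G} v , node-injective {G} v , ((λ ()) , (λ ())) , noInjectiveArrow)
      where
      noInjectiveArrow : node v ⊨ neg (ex (node {Arrow} zero) ⊤AC)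
      noInjectiveArrow (q , q-injective , (q≈V , _) , _) =
        noEdge (fE q zero , trans (src-pres q zero) (q≈V zero) , λ tgt≡ →
          injective-edge-proper q q-injective
            (trans (src-pres q zero) (trans (q≈V zero) (sym tgt≡))))

    from : (∀ v → ¬ ¬ ProperEdgeFrom G v) → p ⊨ acProperEdgeFromEveryNode
    from edges (q , _ , _ , noInjectiveArrow) = edges (fV q zero) λ (e , src≡ , tgt≢) →
      noInjectiveArrow (edge {G} e , edge-injective {G} e (λ eq → tgt≢ (trans (sym eq) src≡)) ,
                        ((λ { zero → src≡ }) , (λ ())) , λ ())

  ⊨acNoInjectiveCospan⇔ : p ⊨ acNoInjectiveCospan ⇔ SourceDeterminedByTarget G
  ⊨acNoInjectiveCospan⇔ = mk⇔ to from
    where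
    to : p ⊨ acNoInjectiveCospan → SourceDeterminedByTarget G
    to sat e₁ e₂ sameTarget v≢w =
      sat (cospan {G} e₁ e₂ sameTarget , cospan-injective {G} e₁ e₂ sameTarget v≢w ,
           ((λ ()) , (λ ())) , λ ())

    from : SourceDeterminedByTarget G → p ⊨ acNoInjectiveCospan
    from sameSource (q , q-injective , _) = sameSource
      (fE q zero , src-pres q zero ,
        separates q q-injective (λ ()) ∘ trans (sym (tgt-pres q zero)))
      (fE q (suc zero) , src-pres q (suc zero) ,
        separates q q-injective (λ ()) ∘ trans (sym (tgt-pres q (suc zero))))
      (trans (tgt-pres q zero) (sym (tgt-pres q (suc zero))))
      (separates q q-injective (λ ()))

  ⊨acNodeWithoutProperEdgeInto⇔ :
    p ⊨ acNodeWithoutProperEdgeInto ⇔ (Σ[ v ∈ V G ] ¬ ProperEdgeInto G v)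
  ⊨acNodeWithoutProperEdgeInto⇔ = mk⇔ to from
    where
    to : p ⊨ acNodeWithoutProperEdgeInto → Σ[ v ∈ V G ] ¬ ProperEdgeInto G v
    to (q , _ , _ , noInjectiveArrow) = fV q zero , λ (e , tgt≡ , src≢) →
      noInjectiveArrow (edge {G} e , edge-injective {G} e (λ eq → src≢ (trans eq tgt≡)) ,
                        ((λ { zero → tgt≡ }) , (λ ())) , λ ())

    from : Σ[ v ∈ V G ] ¬ ProperEdgeInto G v → p ⊨ acNodeWithoutProperEdgeInto
    from (v , noEdge) = node {G} v , node-injective {G} v , ((λ ()) , (λ ())) , noInjectiveArrow
      where
      noInjectiveArrow : node v ⊨ neg (ex (node {Arrow} (suc zero)) ⊤AC)
      noInjectiveArrow (q , q-injective , (q≈V , _) , _) =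
        noEdge (fE q zero , trans (tgt-pres q zero) (q≈V zero) , λ src≡ →
          injective-edge-proper q q-injective
            (trans src≡ (sym (trans (tgt-pres q zero) (q≈V zero)))))

  ⊨acRay⇔RayShaped : p ⊨ acRay ⇔ RayShaped G
  ⊨acRay⇔RayShaped = mk⇔ to from
    where
    to : p ⊨ acRay → RayShaped G
    to sat = record
      { properEdgeFrom = Equivalence.to ⊨acProperEdgeFromEveryNode⇔ (sat zero)
      ; sourceDeterminedByTarget = Equivalence.to ⊨acNoInjectiveCospan⇔ (sat (suc zero))
      ; origin = proj₁ origin
      ; origin-noProperEdgeInto = proj₂ origin
      }
      where
      origin = Equivalence.to ⊨acNodeWithoutProperEdgeInto⇔ (sat (suc (suc zero)))

    from : RayShaped G → p ⊨ acRay
    from ray = λ where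
        zero → Equivalence.from ⊨acProperEdgeFromEveryNode⇔ properEdgeFrom
        (suc zero) → Equivalence.from ⊨acNoInjectiveCospan⇔ sourceDeterminedByTarget
        (suc (suc zero)) →
          Equivalence.from ⊨acNodeWithoutProperEdgeInto⇔ (origin , origin-noProperEdgeInto)
      where open RayShaped ray

finite⇒¬RayShaped : ∀ {G} → FiniteGraph G → ¬ RayShaped G
finite⇒¬RayShaped {G} ((_ , V↔Fin) , (_ , E↔Fin)) ray =
  ↔Fin⇒¬DedekindInfinite V↔Fin successor successor-injective origin successor≢origin
  where
  open RayShaped ray
  _≟_ = ↔Fin⇒≟ V↔Fin

  chosenEdge : ∀ v → ProperEdgeFrom G v
  chosenEdge v = decidable-stable
    (↔Fin⇒any? E↔Fin (λ e → (src G e ≟ v) ×-dec ¬? (tgt G e ≟ v)))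
    (properEdgeFrom v)

  successor : V G → V G
  successor = properEdgeFrom-target ∘ chosenEdge

  successor-injective : Injective _≡_ _≡_ successor
  successor-injective {v} {w} eq =
    decidable-stable (v ≟ w) (sourceDeterminedByTarget (chosenEdge v) (chosenEdge w) eq)

  successor≢origin : ∀ v → successor v ≢ origin
  successor≢origin v eq with chosenEdge v
  ... | e , src≡ , tgt≢ =
    origin-noProperEdgeInto (e , eq , λ src≡origin → tgt≢ (trans eq (trans (sym src≡origin) src≡)))

idH-pushout : ∀ {A C} (g : Hom A C) → IsPushout idH g g idH
idH-pushout g = record
  { commutes = (λ _ → refl) , (λ _ → refl)
  ; universal = λ X u v (u≈V , u≈E) → v ,
      ((λ x → sym (u≈V x)) , (λ e → sym (u≈E e))) , ((λ _ → refl) , (λ _ → refl)) ,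
      λ _ _ w'≈v → w'≈v
  }

infixr 5 _⊕_
_⊕_ : Graph → Graph → Graph
A ⊕ B = record
  { V = V A ⊎ V B
  ; E = E A ⊎ E B
  ; src = map (src A) (src B)
  ; tgt = map (tgt A) (tgt B)
  }

inl : ∀ {A B} → Hom A (A ⊕ B)
inl = record { fV = inj₁ ; fE = inj₁ ; src-pres = λ _ → refl ; tgt-pres = λ _ → refl }

inr : ∀ {A B} → Hom B (A ⊕ B)
inr = record { fV = inj₂ ; fE = inj₂ ; src-pres = λ _ → refl ; tgt-pres = λ _ → refl }

[_,_]H : ∀ {A B X} → Hom A X → Hom B X → Hom (A ⊕ B) X
[ u , v ]H = record
  { fV = [ fV u , fV v ]′
  ; fE = [ fE u , fE v ]′
  ; src-pres = λ { (inj₁ e) → src-pres u e ; (inj₂ e) → src-pres v e }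
  ; tgt-pres = λ { (inj₁ e) → tgt-pres u e ; (inj₂ e) → tgt-pres v e }
  }

⊕-pushout : ∀ {B C} → IsPushout (¡ {B}) (¡ {C}) inl inr
⊕-pushout = record
  { commutes = (λ ()) , (λ ())
  ; universal = λ X u v _ → [ u , v ]H ,
      ((λ _ → refl) , (λ _ → refl)) , ((λ _ → refl) , (λ _ → refl)) ,
      λ w' (w'≈uV , w'≈uE) (w'≈vV , w'≈vE) →
        (λ { (inj₁ x) → w'≈uV x ; (inj₂ x) → w'≈vV x }) ,
        (λ { (inj₁ e) → w'≈uE e ; (inj₂ e) → w'≈vE e })
  }

createNode : Rule
createNode = record
  { L = ∅ ; I = ∅ ; R = •
  ; l = idH ; r = ¡
  ; l-inj = (λ eq → eq) , (λ eq → eq) ; r-inj = ¡-injective {•}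
  ; acL = acRay
  }

createNode-finite : FiniteRule createNode
createNode-finite = finGraph-finite , finGraph-finite , finGraph-finite , acRay-finite

createNodeIn : (G : Graph) → ¡ ⊨ acRay → DirectTrans createNode G (• ⊕ G)
createNodeIn G sat = record
  { m = ¡ ; D = G ; e = ¡ ; k = idH ; c = inr ; n = inl
  ; po₁ = idH-pushout ¡
  ; po₂ = ⊕-pushout
  ; m⊨ac = sat
  }

•⊕-¬RayShaped : ∀ {G} → ¬ RayShaped (• ⊕ G)
•⊕-¬RayShaped ray = RayShaped.properEdgeFrom ray (inj₁ zero) λ where
  (inj₁ () , _)
  (inj₂ _ , () , _)

createNodeTwice : (G : Graph) → ¡ ⊨ acRay → TransPair createNode createNode
createNodeTwice G sat = record { t₁ = createNodeIn G sat ; t₂ = createNodeIn G sat }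

createNodeTwice-dependent : ∀ G (sat : ¡ ⊨ acRay) → ParallelDependent (createNodeTwice G sat)
createNodeTwice-dependent G _ ((d , _ , c∘d⊨acRay) , _) =
  •⊕-¬RayShaped (Equivalence.to (⊨acRay⇔RayShaped (inr ∘H d)) c∘d⊨acRay)

ℕRay : Graph
ℕRay = record { V = ℕ ; E = ℕ ; src = λ n → n ; tgt = suc }

ℕRay-rayShaped : RayShaped ℕRay
ℕRay-rayShaped = record
  { properEdgeFrom = λ v noEdge → noEdge (v , refl , ℕ.1+n≢n)
  ; sourceDeterminedByTarget = λ (_ , src₁ , _) (_ , src₂ , _) sameTarget v≢w →
      v≢w (trans (sym src₁) (trans (ℕ.suc-injective sameTarget) src₂))
  ; origin = 0
  ; origin-noProperEdgeInto = λ (_ , tgt≡0 , _) → ℕ.1+n≢0 tgt≡0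
  }

theorem4 : Σ[ ρ₁ ∈ Rule ] Σ[ ρ₂ ∈ Rule ] (FiniteRule ρ₁ × FiniteRule ρ₂ ×
             ((s : ℕ) (S : Fin s → TransPair ρ₁ ρ₂) → ((i : Fin s) → FinitePair (S i)) →
               ¬ Complete s S))
theorem4 = createNode , createNode , createNode-finite , createNode-finite ,
  λ s S S-finite complete →
    let ℕRay⊨acRay = Equivalence.from (⊨acRay⇔RayShaped ¡) ℕRay-rayShaped
        (i , _) = complete (createNodeTwice ℕRay ℕRay⊨acRay)
                           (createNodeTwice-dependent ℕRay ℕRay⊨acRay)
    in finite⇒¬RayShaped (proj₁ (S-finite i))
         (Equivalence.to (⊨acRay⇔RayShaped _) (m⊨ac (t₁ (S i))))
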